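{- For any integers $\ell\ge1$ and $n\ge1$, any set of $n2^{\ell}$ distinct binary strings contains $n$ strings sharing a common prefix of length at least $\ell$.
   Context: Binary strings are finite sequences over $\{0,1\}$, possibly empty. $n$ strings share a common prefix of length at least $\ell$ if each has length at least $\ell$ and they agree in their first $\ell$ symbols. -}

module Defs where

open import Data.Bool using (Bool)
open import Data.List using (List; length; _++_)
open import Data.Nat using (ℕ)
open import Data.Product using (∃)
open import Relation.Binary.PropositionalEquality using (_≡_)

BinStr : Set
BinStr = List Bool

_IsPrefixOf_ : BinStr → BinStr → Set
p IsPrefixOf s = ∃ λ rest → s ≡ p ++ rest

-- Induction on ℓ, by pigeonhole on the first bit. Among ≥ 2m distinct strings at
-- most one is empty, so one of the two classes "starts with 0" / "starts with 1"
-- has ≥ m members; stripping that first bit keeps them distinct, and a cluster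
-- with a common prefix of length ℓ among the stripped strings lifts back to one
-- of length ℓ + 1.
module Submission where

open import Defs
open import Data.Bool using (Bool; true; false; _≟_)
open import Data.Empty using (⊥-elim)
open import Data.List using (List; []; _∷_; length; map; take)
open import Data.List.Properties using (length-map; length-take)
open import Data.List.Relation.Unary.All using (All; []; _∷_; universal)
open import Data.List.Relation.Unary.All.Properties using (anti-mono)
open import Data.List.Relation.Unary.AllPairs using ([]; _∷_)
open import Data.List.Relation.Unary.Unique.Propositional using (Unique)
open import Data.List.Relation.Unary.Unique.Propositional.Properties using (map⁻)
open import Data.List.Relation.Binary.Sublist.Propositional
  using (_⊆_; []; _∷_; _∷ʳ_; lookup; ⊆-trans)
open import Data.List.Relation.Binary.Sublist.Propositional.Properties
  using (take-⊆)
  renaming (map⁺ to ⊆-map⁺)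
open import Data.Nat using (ℕ; zero; suc; _*_; _^_; _≤_; _<_; _+_; z≤n; s≤s; _≤?_)
open import Data.Nat.Properties
  using ( ≤-trans; ≤-reflexive; <⇒≱; ≰⇒>; +-suc; +-mono-≤; n<1+n; *-identityʳ
        ; m≤n⇒m⊓n≡m; module ≤-Reasoning)
open import Data.Nat.Tactic.RingSolver using (solve-∀)
open import Data.Product using (Σ; _×_; _,_)
open import Data.Sum using (_⊎_; inj₁; inj₂)
open import Relation.Binary.PropositionalEquality using (_≡_; _≢_; refl; sym; trans; cong; subst)
open import Relation.Nullary using (yes; no)

Unique-resp-⊆ : {A : Set} {xs ys : List A} → xs ⊆ ys → Unique ys → Unique xs
Unique-resp-⊆ []         []          = []
Unique-resp-⊆ (y ∷ʳ τ)   (_ ∷ u)     = Unique-resp-⊆ τ u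
Unique-resp-⊆ (refl ∷ τ) (y∉ys ∷ u)  = anti-mono (lookup τ) y∉ys ∷ Unique-resp-⊆ τ u

branch : Bool → List BinStr → List BinStr
branch b []             = []
branch b ([] ∷ S)       = branch b S
branch b ((c ∷ s) ∷ S) with c ≟ b
... | yes _ = s ∷ branch b S
... | no  _ = branch b S

map-∷-branch-⊆ : ∀ b S → map (b ∷_) (branch b S) ⊆ S
map-∷-branch-⊆ b []             = []
map-∷-branch-⊆ b ([] ∷ S)       = [] ∷ʳ map-∷-branch-⊆ b S
map-∷-branch-⊆ b ((c ∷ s) ∷ S) with c ≟ b
... | yes refl = refl ∷ map-∷-branch-⊆ b S
... | no  _    = (c ∷ s) ∷ʳ map-∷-branch-⊆ b S

branch-unique : ∀ b {S} → Unique S → Unique (branch b S)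
branch-unique b {S} u = map⁻ (Unique-resp-⊆ (map-∷-branch-⊆ b S) u)

length-branches : ∀ S → All ([] ≢_) S →
  length S ≡ length (branch false S) + length (branch true S)
length-branches []                 []          = refl
length-branches ([] ∷ S)           (≢[] ∷ _)   = ⊥-elim (≢[] refl)
length-branches ((false ∷ s) ∷ S)  (_ ∷ ≢[]s)  = cong suc (length-branches S ≢[]s)
length-branches ((true ∷ s) ∷ S)   (_ ∷ ≢[]s)  =
  trans (cong suc (length-branches S ≢[]s)) (sym (+-suc _ _))

length-unique≤ : ∀ {S} → Unique S →
  length S ≤ suc (length (branch false S) + length (branch true S))
length-unique≤ {[]}               []         = z≤n
length-unique≤ {[] ∷ S}           (≢[] ∷ _)  = s≤s (≤-reflexive (length-branches S ≢[]))
length-unique≤ {(false ∷ s) ∷ S}  (_ ∷ u)    = s≤s (length-unique≤ u)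
length-unique≤ {(true ∷ s) ∷ S}   (_ ∷ u)    =
  ≤-trans (s≤s (length-unique≤ u)) (s≤s (≤-reflexive (sym (+-suc _ _))))

large-branch : ∀ m {S} → Unique S → m + m ≤ length S →
  m ≤ length (branch false S) ⊎ m ≤ length (branch true S)
large-branch m {S} u m+m≤ with m ≤? length (branch false S) | m ≤? length (branch true S)
... | yes big | _       = inj₁ big
... | no  _   | yes big = inj₂ big
... | no  m≰a | no  m≰c = ⊥-elim (<⇒≱ S<m+m m+m≤)
  where
  open ≤-Reasoning
  a = length (branch false S)
  c = length (branch true S)
  S<m+m : length S < m + m
  S<m+m = begin-strict
    length S         ≤⟨ length-unique≤ u ⟩
    suc (a + c)      <⟨ n<1+n _ ⟩
    suc (suc a + c)  ≡⟨ sym (+-suc (suc a) c) ⟩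
    suc a + suc c    ≤⟨ +-mono-≤ (≰⇒> m≰a) (≰⇒> m≰c) ⟩
    m + m            ∎

PrefixCluster : ℕ → ℕ → List BinStr → Set
PrefixCluster n ℓ S = Σ (List BinStr) λ T → Σ BinStr λ p →
  T ⊆ S × length T ≡ n × length p ≡ ℓ × All (p IsPrefixOf_) T

root-cluster : ∀ n S → n ≤ length S → PrefixCluster n 0 S
root-cluster n S n≤ =
  take n S , [] , take-⊆ n S , trans (length-take n S) (m≤n⇒m⊓n≡m n≤) , refl ,
  universal (λ s → s , refl) (take n S)

lift-cluster : ∀ b {n ℓ S} → PrefixCluster n ℓ (branch b S) → PrefixCluster n (suc ℓ) S
lift-cluster b {S = S} (T , p , T⊆ , |T| , |p| , p≼T) =
  map (b ∷_) T , b ∷ p , ⊆-trans (⊆-map⁺ (b ∷_) T⊆) (map-∷-branch-⊆ b S) ,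
  trans (length-map (b ∷_) T) |T| , cong suc |p| , lift-prefixes p≼T
  where
  lift-prefixes : ∀ {T} → All (p IsPrefixOf_) T → All ((b ∷ p) IsPrefixOf_) (map (b ∷_) T)
  lift-prefixes []                    = []
  lift-prefixes ((r , s≡p++r) ∷ p≼T)  = (r , cong (b ∷_) s≡p++r) ∷ lift-prefixes p≼T

*-2^suc : ∀ n ℓ → n * 2 ^ suc ℓ ≡ n * 2 ^ ℓ + n * 2 ^ ℓ
*-2^suc n ℓ = double n (2 ^ ℓ)
  where
  double : ∀ n k → n * (2 * k) ≡ n * k + n * k
  double = solve-∀

prefix-pigeonhole : ∀ ℓ n {S} → Unique S → n * 2 ^ ℓ ≤ length S → PrefixCluster n ℓ S
prefix-pigeonhole zero    n {S} _ n*1≤ = root-cluster n S (subst (_≤ length S) (*-identityʳ n) n*1≤)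
prefix-pigeonhole (suc ℓ) n {S} u le
  with large-branch (n * 2 ^ ℓ) u (subst (_≤ length S) (*-2^suc n ℓ) le)
... | inj₁ big = lift-cluster false (prefix-pigeonhole ℓ n (branch-unique false u) big)
... | inj₂ big = lift-cluster true  (prefix-pigeonhole ℓ n (branch-unique true u) big)

lemma5p4 : (ℓ n : ℕ) → 1 ≤ ℓ → 1 ≤ n →
    (S : List BinStr) → Unique S → length S ≡ n * 2 ^ ℓ →
    Σ (List BinStr) λ T → Σ BinStr λ p →
      T ⊆ S × length T ≡ n × length p ≡ ℓ × All (p IsPrefixOf_) T
lemma5p4 ℓ n _ _ S u |S| = prefix-pigeonhole ℓ n u (≤-reflexive (sym |S|))
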